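{- Let $\mathbb{K}=(G,M,I)$ be a context and $\mathbb{KC}_{SD}=((G,E_1),(M,E_2),I)$ the associated Kripke context. If a semiconcept $(A,B)$ of $\mathbb{K}$ is a concept of $\mathbb{K}$, then it is a definable semiconcept of $\mathbb{KC}_{SD}$.
   Context: A context is $\mathbb{K}=(G,M,I)$ with $I\subseteq G\times M$. For $A\subseteq G$, $A'=\{m\in M:gIm\ \forall g\in A\}$; for $B\subseteq M$, $B'=\{g\in G:gIm\ \forall m\in B\}$. A semiconcept is a pair $(A,B)$ with $A'=B$ or $B'=A$; a concept is a pair with $A'=B$ and $B'=A$. Define equivalence relations $E_1$ on $G$ by $g_1E_1g_2$ iff $I(g_1)=I(g_2)$, where $I(g)=\{m:gIm\}$, and $E_2$ on $M$ by $m_1E_2m_2$ iff $I^{ -1}(m_1)=I^{ -1}(m_2)$, where $I^{ -1}(m)=\{g:gIm\}$; $\mathbb{KC}_{SD}:=((G,E_1),(M,E_2),I)$. For an equivalence relation $E$ on a set $W$, a category of $(W,E)$ is a union of $E$-equivalence classes. A definable semiconcept of $\mathbb{KC}_{SD}$ is a semiconcept $(A,B)$ of $\mathbb{K}$ such that $A$ is a category of $(G,E_1)$ and $B$ is a category of $(M,E_2)$. -}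

module Defs where

open import Level using (Level; _⊔_; suc)
open import Data.Product using (Σ; _×_; _,_; ∃)
open import Data.Sum using (_⊎_)

Subset : ∀ {a} → Set a → (ℓ : Level) → Set (a ⊔ suc ℓ)
Subset X ℓ = X → Set ℓ

_⊆_ : ∀ {a ℓ₁ ℓ₂} {X : Set a} → Subset X ℓ₁ → Subset X ℓ₂ → Set (a ⊔ ℓ₁ ⊔ ℓ₂)
S ⊆ T = ∀ x → S x → T x

_≐_ : ∀ {a ℓ₁ ℓ₂} {X : Set a} → Subset X ℓ₁ → Subset X ℓ₂ → Set (a ⊔ ℓ₁ ⊔ ℓ₂)
S ≐ T = (S ⊆ T) × (T ⊆ S)

record Context (o a ℓ : Level) : Set (suc (o ⊔ a ⊔ ℓ)) where
  field
    G : Set o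
    M : Set a
    I : G → M → Set ℓ

module _ {o a ℓ : Level} (K : Context o a ℓ) where
  open Context K

  _′ᴳ : ∀ {ℓ'} → Subset G ℓ' → Subset M (o ⊔ ℓ' ⊔ ℓ)
  (A ′ᴳ) m = ∀ g → A g → I g m

  _′ᴹ : ∀ {ℓ'} → Subset M ℓ' → Subset G (a ⊔ ℓ' ⊔ ℓ)
  (B ′ᴹ) g = ∀ m → B m → I g m

  IsSemiconcept : ∀ {ℓ'} → Subset G ℓ' → Subset M ℓ' → Set _
  IsSemiconcept A B = ((A ′ᴳ) ≐ B) ⊎ ((B ′ᴹ) ≐ A)

  IsConcept : ∀ {ℓ'} → Subset G ℓ' → Subset M ℓ' → Set _
  IsConcept A B = ((A ′ᴳ) ≐ B) × ((B ′ᴹ) ≐ A)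

  Iof : G → Subset M ℓ
  Iof g m = I g m

  Iinv : M → Subset G ℓ
  Iinv m g = I g m

  E₁ : G → G → Set _
  E₁ g₁ g₂ = Iof g₁ ≐ Iof g₂

  E₂ : M → M → Set _
  E₂ m₁ m₂ = Iinv m₁ ≐ Iinv m₂

-- A category of (W, E): a union of E-equivalence classes, i.e. there is a
-- family S of representatives with  A = ⋃_{s ∈ S} [s]_E.
IsCategory : ∀ {w e c} {W : Set w} (E : W → W → Set e) → Subset W c → Set (w ⊔ e ⊔ suc c)
IsCategory {w} {e} {c} {W} E A =
  Σ (Subset W c) λ S → A ≐ (λ x → Σ W λ s → S s × E s x)

module _ {o a ℓ : Level} (K : Context o a ℓ) where
  open Context K

  IsDefinableSemiconcept : ∀ {ℓ'} → Subset G ℓ' → Subset M ℓ' → Set _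
  IsDefinableSemiconcept A B =
    IsSemiconcept K A B × IsCategory (E₁ K) A × IsCategory (E₂ K) B

{-# OPTIONS --safe #-}
module Submission where

open import Level using (Level; _⊔_; suc)
open import Data.Product using (_,_)
open import Relation.Binary.Definitions using (Reflexive)
open import Defs

-- The extent and intent of a concept are derived sets, and a derived set only
-- depends on the rows (resp. columns) of the incidence relation; hence it is a
-- union of E₁- (resp. E₂-) classes, each element representing its own class.

≐-sym : ∀ {x c d} {X : Set x} {S : Subset X c} {T : Subset X d} → S ≐ T → T ≐ S
≐-sym (S⊆T , T⊆S) = T⊆S , S⊆T

module _ {w e : Level} {W : Set w} (E : W → W → Set e) where

  ClosedUnder : ∀ {c} → Subset W c → Set (w ⊔ e ⊔ c)
  ClosedUnder S = ∀ {x y} → E x y → S x → S y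

  closedUnder-≐ : ∀ {c d} {S : Subset W c} {T : Subset W d} →
                  S ≐ T → ClosedUnder T → ClosedUnder S
  closedUnder-≐ (S⊆T , T⊆S) closed xEy Sx = T⊆S _ (closed xEy (S⊆T _ Sx))

  closed⇒category : ∀ {c} → Reflexive E → (S : Subset W c) → ClosedUnder S → IsCategory E S
  closed⇒category refl S closed =
    S , (λ x Sx → x , Sx , refl) , (λ { x (s , Ss , sEx) → closed sEx Ss })

module _ {o a ℓ : Level} (K : Context o a ℓ) where
  open Context K

  E₁-refl : Reflexive (E₁ K)
  E₁-refl = (λ _ p → p) , (λ _ p → p)

  E₂-refl : Reflexive (E₂ K)
  E₂-refl = (λ _ p → p) , (λ _ p → p)

  ′ᴹ-closedUnder-E₁ : ∀ {ℓ'} (B : Subset M ℓ') → ClosedUnder (E₁ K) ((K ′ᴹ) B)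
  ′ᴹ-closedUnder-E₁ B (I[g]⊆I[h] , _) gB′ m Bm = I[g]⊆I[h] m (gB′ m Bm)

  ′ᴳ-closedUnder-E₂ : ∀ {ℓ'} (A : Subset G ℓ') → ClosedUnder (E₂ K) ((K ′ᴳ) A)
  ′ᴳ-closedUnder-E₂ A (I⁻¹[m]⊆I⁻¹[n] , _) mA′ g Ag = I⁻¹[m]⊆I⁻¹[n] g (mA′ g Ag)

proposition96 : ∀ {o a ℓ ℓ'} (K : Context o a ℓ)
    (A : Subset (Context.G K) ℓ') (B : Subset (Context.M K) ℓ') →
    IsSemiconcept K A B → IsConcept K A B → IsDefinableSemiconcept K A B
proposition96 K A B semiconcept (A′≐B , B′≐A) =
  semiconcept
  , closed⇒category (E₁ K) (E₁-refl K) A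
      (closedUnder-≐ (E₁ K) (≐-sym B′≐A) (′ᴹ-closedUnder-E₁ K B))
  , closed⇒category (E₂ K) (E₂-refl K) B
      (closedUnder-≐ (E₂ K) (≐-sym A′≐B) (′ᴳ-closedUnder-E₂ K A))
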